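{- Let $1<k<d$. The growth constant of $(d,k)$ self-avoiding manifolds satisfies $$\mu^{\mathrm{SAM}}_{(d,k)}\ge k(d-k+1).$$
   Context: A $k$-face of $\mathbb{Z}^d$ is a set $\{x\in\mathbb{R}^d:|x_i-b_i|\le\frac12\ (i\in H),\ x_i=b_i\ (i\notin H)\}$ with $|H|=k$, $b_i\in\mathbb{Z}+\frac12$ for $i\in H$, $b_i\in\mathbb{Z}$ otherwise; $(k-1)$-faces analogously. A $(d,k)$ self-avoiding manifold (SAM) of $k$-area $n$ is a set of $n$ $k$-faces such that every $(k-1)$-face lies in at most two of them and the graph joining faces sharing a $(k-1)$-face is connected; counted up to translation by $\mathbb{Z}^d$, giving $c_n$. $\mu^{\mathrm{SAM}}_{(d,k)}=\lim_n c_n^{1/n}$, which exists. -}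

module Defs where

open import Data.Nat using (ℕ; _∸_)
open import Data.Integer using (ℤ; _+_; 1ℤ)
open import Data.Fin using (Fin)
open import Data.Fin.Subset using (Subset; Side; inside; outside; ∣_∣)
open import Data.Vec using (lookup)
open import Data.Empty using (⊥)
open import Data.Unit using (⊤)
open import Data.Product using (Σ; ∃; _×_; _,_)
open import Data.Sum using (_⊎_)
open import Relation.Nullary using (¬_)
open import Relation.Binary.PropositionalEquality using (_≡_)
open import Relation.Binary.Construct.Closure.ReflexiveTransitive using (Star)

-- A face of the cubic lattice Z^d, encoded by its set H of free directions
-- and its "lower corner" v : Z^d.  It denotes the point set
--   { x ∈ R^d : v_i ≤ x_i ≤ v_i + 1 (i ∈ H),  x_i = v_i (i ∉ H) },
-- i.e. the paper's face with centre b_i = v_i + 1/2 (i ∈ H), b_i = v_i (i ∉ H).  This encoding is a bijection onto the faces of Z^d.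
record Face (d : ℕ) : Set where
  constructor face
  field
    dirs : Subset d
    base : Fin d → ℤ
open Face public

dim : ∀ {d} → Face d → ℕ
dim f = ∣ dirs f ∣

coordIncl : Side → Side → ℤ → ℤ → Set
coordIncl inside  inside  w v = w ≡ v
coordIncl inside  outside w v = ⊥
coordIncl outside outside w v = w ≡ v
coordIncl outside inside  w v = w ≡ v ⊎ w ≡ v + 1ℤ

-- g ⊑ f : the face g is contained (as a point set) in the face f.
_⊑_ : ∀ {d} → Face d → Face d → Set
g ⊑ f = ∀ i → coordIncl (lookup (dirs g) i) (lookup (dirs f) i) (base g i) (base f i)

FaceEq : ∀ {d} → Face d → Face d → Set
FaceEq f g = (dirs f ≡ dirs g) × (∀ i → base f i ≡ base g i)

translate : ∀ {d} → (Fin d → ℤ) → Face d → Face d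
translate t f = face (dirs f) (λ i → t i + base f i)

Adj : ∀ {d n} (k : ℕ) → (Fin n → Face d) → Fin n → Fin n → Set
Adj {d} k F i j = ¬ (i ≡ j) × Σ (Face d) (λ g → (dim g ≡ k ∸ 1) × (g ⊑ F i) × (g ⊑ F j))

-- A (d,k) self-avoiding manifold of k-area n, given as an injective
-- enumeration F : Fin n → Face d of its n distinct k-faces.
record IsSAM (d k n : ℕ) (F : Fin n → Face d) : Set where
  field
    distinct   : ∀ i j → FaceEq (F i) (F j) → i ≡ j
    kFaces     : ∀ i → dim (F i) ≡ k
    atMostTwo  : ∀ (g : Face d) → dim g ≡ k ∸ 1 → ∀ i j l →
                 g ⊑ F i → g ⊑ F j → g ⊑ F l → (i ≡ j) ⊎ (j ≡ l) ⊎ (i ≡ l)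
    connected  : ∀ i j → Star (Adj k F) i j

SAM : ℕ → ℕ → ℕ → Set
SAM d k n = Σ (Fin n → Face d) (IsSAM d k n)

-- The face set of B is a translate of the face set of A (same area n;
-- injectivity makes "image(A + t) ⊆ image B" equivalent to equality).
Translates : ∀ {d k n} → SAM d k n → SAM d k n → Set
Translates {d} {k} {n} (A , _) (B , _) =
  Σ (Fin d → ℤ) (λ t → ∀ (i : Fin n) → Σ (Fin n) (λ j → FaceEq (translate t (A i)) (B j)))

-- c_n ≥ m : there are m pairwise non-translation-equivalent (d,k) SAMs of
-- k-area n, i.e. at least m translation classes.
AtLeastClasses : ℕ → ℕ → ℕ → ℕ → Set
AtLeastClasses d k n m =
  Σ (Fin m → SAM d k n) (λ S → ∀ i j → Translates (S i) (S j) → i ≡ j)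

-- A staircase is a sequence of k-faces F₀, …, F_r in which F_{t+1} arises from F_t by dropping
-- one of its free directions i, moving one unit up along i, and freeing one of the d - k + 1
-- directions other than the remaining k - 1 free ones; consecutive faces share the (k-1)-face between them.  The level
-- (sum of base coordinates) rises by exactly one per step, while a (k-1)-face of a k-face lies at
-- the same level or one above.  Hence each (k-1)-face lies in at most two faces of a staircase,
-- the faces are distinct, and a translation between two staircases from the same origin
-- preserves levels and so is trivial.  The (k (d - k + 1))^r move sequences therefore give as
-- many translation classes of SAMs of area r + 1, and by Bernoulli's inequality this number
-- eventually exceeds (a / b)^(r+1) whenever a / b < k (d - k + 1).

module Submission where

open import Defs
open import Data.Nat using (ℕ; _+_; _*_; _∸_; _^_; _<_; _≤_)
open import Data.Product using (Σ; _×_)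
open import Data.Nat using (zero; suc; z≤n; s≤s; NonZero; >-nonZero; >-nonZero⁻¹)
import Data.Nat.Properties as ℕ
open import Data.Nat.Tactic.RingSolver using (solve-∀)
open import Data.Integer as ℤ using (ℤ; +_; 0ℤ; 1ℤ) renaming (suc to sucℤ)
import Data.Integer.Properties as ℤ
open import Data.Fin using (Fin; zero; suc; toℕ; inject₁; fromℕ; cast; remQuot; combine; finToFun; funToFin)
import Data.Fin.Properties as Fin
open import Data.Fin.Subset using (Subset; inside; outside; ∣_∣; ∁)
import Data.Fin.Subset as Subset
import Data.Fin.Subset.Properties as Subset
open import Data.Vec using ([]; _∷_; lookup; _[_]≔_)
import Data.Vec.Properties as Vec
open import Data.Vec.Functional using (Vector; head; tail; updateAt)
import Data.Vec.Functional.Properties as Vector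
open import Data.Bool using (not)
open import Data.Bool.Properties using (not-injective)
open import Data.Product using (_,_; proj₁; proj₂; uncurry)
open import Data.Sum using (_⊎_; inj₁; inj₂)
import Data.Sum as Sum
open import Function using (_∘_; id)
open import Relation.Nullary using (yes; no; contradiction)
open import Relation.Binary.Core using (Rel)
open import Relation.Binary.PropositionalEquality
open import Relation.Binary.Construct.Closure.ReflexiveTransitive using (Star; ε; _◅_; _◅◅_; gmap; reverse)
open import Algebra.Properties.CommutativeMonoid.Sum ℤ.+-0-commutativeMonoid
  using (sum; sum-cong-≗; sum-replicate-zero; ∑-distrib-+)
open import Algebra.Properties.AbelianGroup ℤ.+-0-abelianGroup using (identityˡ-unique)
import Algebra.Properties.CommutativeSemigroup as CommutativeSemigroupProperties

private
  module ℕ+ = CommutativeSemigroupProperties ℕ.+-commutativeSemigroup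
  module ℕ* = CommutativeSemigroupProperties ℕ.*-commutativeSemigroup
  module ℤ+ = CommutativeSemigroupProperties ℤ.+-commutativeSemigroup

^-distribʳ-* : ∀ m n o → (m * n) ^ o ≡ m ^ o * n ^ o
^-distribʳ-* m n zero    = refl
^-distribʳ-* m n (suc o) = begin
  m * n * (m * n) ^ o       ≡⟨ cong (m * n *_) (^-distribʳ-* m n o) ⟩
  m * n * (m ^ o * n ^ o)   ≡⟨ ℕ*.interchange m n (m ^ o) (n ^ o) ⟩
  m * m ^ o * (n * n ^ o)   ∎
  where open ≡-Reasoning

bernoulli : ∀ x n → (x + n) * x ^ n ≤ x * suc x ^ n
bernoulli x zero    = ℕ.≤-reflexive (cong (_* 1) (ℕ.+-identityʳ x))
bernoulli x (suc n) = begin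
  (x + suc n) * (x * x ^ n)             ≤⟨ ℕ.m≤m+n _ (n * x ^ n) ⟩
  (x + suc n) * (x * x ^ n) + n * x ^ n ≡⟨ expand x n (x ^ n) ⟩
  suc x * ((x + n) * x ^ n)             ≤⟨ ℕ.*-monoʳ-≤ (suc x) (bernoulli x n) ⟩
  suc x * (x * suc x ^ n)               ≡⟨ ℕ*.x∙yz≈y∙xz (suc x) x (suc x ^ n) ⟩
  x * (suc x * suc x ^ n)               ∎
  where
  open ℕ.≤-Reasoning
  expand : ∀ x n y → (x + suc n) * (x * y) + n * y ≡ suc x * ((x + n) * y)
  expand = solve-∀

x*L≤n⇒L*x^n<[1+x]^n : ∀ {x} L n .{{_ : NonZero x}} → x * L ≤ n → L * x ^ n < suc x ^ n
x*L≤n⇒L*x^n<[1+x]^n {x} L n xL≤n = ℕ.*-cancelˡ-< x _ _ (begin-strict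
  x * (L * x ^ n)   ≡⟨ ℕ.*-assoc x L (x ^ n) ⟨
  x * L * x ^ n     ≤⟨ ℕ.*-monoˡ-≤ (x ^ n) xL≤n ⟩
  n * x ^ n         <⟨ ℕ.*-monoˡ-< (x ^ n) {{ℕ.m^n≢0 x n}} (ℕ.m<n+m n (>-nonZero⁻¹ x)) ⟩
  (x + n) * x ^ n   ≤⟨ bernoulli x n ⟩
  x * suc x ^ n     ∎)
  where open ℕ.≤-Reasoning

a^[1+r]<b^[1+r]*L^r : ∀ {a b L} r → a < b * L → a * L ≤ suc r → a ^ suc r < b ^ suc r * L ^ r
a^[1+r]<b^[1+r]*L^r {zero} {b} {L} r 0<bL _ = >-nonZero⁻¹ _ {{ℕ.m*n≢0 (b ^ suc r) (L ^ r)}}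
  where
  instance
    _ : NonZero (b * L)
    _ = >-nonZero 0<bL
    _ : NonZero (b ^ suc r)
    _ = ℕ.m^n≢0 b (suc r) {{ℕ.m*n≢0⇒m≢0 b}}
    _ : NonZero (L ^ r)
    _ = ℕ.m^n≢0 L r {{ℕ.m*n≢0⇒n≢0 b}}
a^[1+r]<b^[1+r]*L^r {suc x} {b} {L} r a<bL aL≤1+r = ℕ.*-cancelˡ-< L _ _ (begin-strict
  L * suc x ^ suc r         <⟨ x*L≤n⇒L*x^n<[1+x]^n L (suc r) aL≤1+r ⟩
  suc (suc x) ^ suc r       ≤⟨ ℕ.^-monoˡ-≤ (suc r) a<bL ⟩
  (b * L) ^ suc r           ≡⟨ ^-distribʳ-* b L (suc r) ⟩
  b ^ suc r * (L * L ^ r)   ≡⟨ ℕ*.x∙yz≈y∙xz (b ^ suc r) L (L ^ r) ⟩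
  L * (b ^ suc r * L ^ r)   ∎)
  where open ℕ.≤-Reasoning

member : ∀ {n} (p : Subset n) → Fin ∣ p ∣ → Fin n
member (inside  ∷ p) zero    = zero
member (inside  ∷ p) (suc x) = suc (member p x)
member (outside ∷ p) x       = suc (member p x)

member∈ : ∀ {n} (p : Subset n) x → lookup p (member p x) ≡ inside
member∈ (inside  ∷ p) zero    = refl
member∈ (inside  ∷ p) (suc x) = member∈ p x
member∈ (outside ∷ p) x       = member∈ p x

member-injective : ∀ {n} (p : Subset n) {x y} → member p x ≡ member p y → x ≡ y
member-injective (inside  ∷ p) {zero}  {zero}  _  = refl
member-injective (inside  ∷ p) {suc x} {suc y} eq = cong suc (member-injective p (Fin.suc-injective eq))
member-injective (outside ∷ p)                 eq = member-injective p (Fin.suc-injective eq)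

lookup-∁ : ∀ {n} (p : Subset n) i → lookup (∁ p) i ≡ inside → lookup p i ≡ outside
lookup-∁ p i i∈∁p = not-injective (trans (sym (Vec.lookup-map i _ p)) i∈∁p)

suc∣p[i]≔outside∣≡∣p∣ : ∀ {n} (p : Subset n) i → lookup p i ≡ inside → suc ∣ p [ i ]≔ outside ∣ ≡ ∣ p ∣
suc∣p[i]≔outside∣≡∣p∣ (inside  ∷ p) zero    _   = refl
suc∣p[i]≔outside∣≡∣p∣ (inside  ∷ p) (suc i) i∈p = cong suc (suc∣p[i]≔outside∣≡∣p∣ p i i∈p)
suc∣p[i]≔outside∣≡∣p∣ (outside ∷ p) (suc i) i∈p = suc∣p[i]≔outside∣≡∣p∣ p i i∈p

∣p[i]≔inside∣≡suc∣p∣ : ∀ {n} (p : Subset n) i → lookup p i ≡ outside → ∣ p [ i ]≔ inside ∣ ≡ suc ∣ p ∣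
∣p[i]≔inside∣≡suc∣p∣ (outside ∷ p) zero    _   = refl
∣p[i]≔inside∣≡suc∣p∣ (inside  ∷ p) (suc i) i∉p = cong suc (∣p[i]≔inside∣≡suc∣p∣ p i i∉p)
∣p[i]≔inside∣≡suc∣p∣ (outside ∷ p) (suc i) i∉p = ∣p[i]≔inside∣≡suc∣p∣ p i i∉p

∣∁[p[i]≔outside]∣≡suc∣∁p∣ : ∀ {n} (p : Subset n) i → lookup p i ≡ inside → ∣ ∁ (p [ i ]≔ outside) ∣ ≡ suc ∣ ∁ p ∣
∣∁[p[i]≔outside]∣≡suc∣∁p∣ p i i∈p = begin
  ∣ ∁ (p [ i ]≔ outside) ∣  ≡⟨ cong ∣_∣ (Vec.map-updateAt p i refl) ⟩
  ∣ ∁ p [ i ]≔ inside ∣     ≡⟨ ∣p[i]≔inside∣≡suc∣p∣ (∁ p) i (trans (Vec.lookup-map i _ p) (cong not i∈p)) ⟩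
  suc ∣ ∁ p ∣               ∎
  where open ≡-Reasoning

[]≔inside-injective : ∀ {n} (p : Subset n) {i j} → lookup p i ≡ outside → p [ i ]≔ inside ≡ p [ j ]≔ inside → i ≡ j
[]≔inside-injective p {i} {j} i∉p eq with i Fin.≟ j
... | yes i≡j = i≡j
... | no  i≢j with () ← trans (sym (Vec.lookup∘update i p inside))
                          (trans (cong (λ q → lookup q i) eq) (trans (Vec.lookup∘update′ i≢j p inside) i∉p))

cast-injective : ∀ {m n} .(eq : m ≡ n) {x y : Fin m} → cast eq x ≡ cast eq y → x ≡ y
cast-injective eq {x} {y} cx≡cy = begin
  x                          ≡⟨ Fin.cast-involutive (sym eq) eq x ⟨
  cast (sym eq) (cast eq x)  ≡⟨ cong (cast (sym eq)) cx≡cy ⟩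
  cast (sym eq) (cast eq y)  ≡⟨ Fin.cast-involutive (sym eq) eq y ⟩
  y                          ∎
  where open ≡-Reasoning

finToFun-injective : ∀ m n {x y : Fin (m ^ n)} → (∀ i → finToFun {m} {n} x i ≡ finToFun y i) → x ≡ y
finToFun-injective m n {x} {y} eq = begin
  x                              ≡⟨ Fin.funToFin-finToFin {n} {m} x ⟨
  funToFin (finToFun {m} {n} x)  ≡⟨ funToFin-cong eq ⟩
  funToFin (finToFun {m} {n} y)  ≡⟨ Fin.funToFin-finToFin {n} {m} y ⟩
  y                              ∎
  where
  open ≡-Reasoning
  funToFin-cong : ∀ {n} {f g : Fin n → Fin m} → (∀ i → f i ≡ g i) → funToFin f ≡ funToFin g
  funToFin-cong {zero}  eq = refl
  funToFin-cong {suc n} eq = cong₂ combine (eq zero) (funToFin-cong (eq ∘ suc))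

remQuot-injective : ∀ m n {x y : Fin (m * n)} → remQuot {m} n x ≡ remQuot n y → x ≡ y
remQuot-injective m n {x} {y} eq =
  trans (sym (Fin.combine-remQuot {m} n x)) (trans (cong (uncurry (combine {m} {n})) eq) (Fin.combine-remQuot {m} n y))

≤1-pigeonhole : ∀ {x y z} → x ≤ 1 → y ≤ 1 → z ≤ 1 → x ≡ y ⊎ y ≡ z ⊎ x ≡ z
≤1-pigeonhole z≤n       z≤n       _         = inj₁ refl
≤1-pigeonhole (s≤s z≤n) (s≤s z≤n) _         = inj₁ refl
≤1-pigeonhole z≤n       (s≤s z≤n) z≤n       = inj₂ (inj₂ refl)
≤1-pigeonhole z≤n       (s≤s z≤n) (s≤s z≤n) = inj₂ (inj₁ refl)
≤1-pigeonhole (s≤s z≤n) z≤n       z≤n       = inj₂ (inj₁ refl)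
≤1-pigeonhole (s≤s z≤n) z≤n       (s≤s z≤n) = inj₂ (inj₂ refl)

star-from-zero : ∀ {ℓ r} (R : Rel (Fin (suc r)) ℓ) → (∀ i → R (inject₁ i) (suc i)) → ∀ i → Star R zero i
star-from-zero R next zero = ε
star-from-zero {r = suc r} R next (suc i) =
  next zero ◅ gmap suc id (star-from-zero (λ a b → R (suc a) (suc b)) (next ∘ suc) i)

level : ∀ {d} → Face d → ℤ
level f = sum (base f)

level-cong : ∀ {d} {f g : Face d} → FaceEq f g → level f ≡ level g
level-cong (_ , base≡) = sum-cong-≗ base≡

level-translate : ∀ {d} (t : Fin d → ℤ) (f : Face d) → level (translate t f) ≡ sum t ℤ.+ level f
level-translate t f = ∑-distrib-+ t (base f)

sum-updateAt-sucℤ : ∀ {d} (v : Vector ℤ d) i → sum (updateAt v i sucℤ) ≡ sucℤ (sum v)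
sum-updateAt-sucℤ v zero    = ℤ.+-assoc 1ℤ (head v) (sum (tail v))
sum-updateAt-sucℤ v (suc i) = begin
  head v ℤ.+ sum (updateAt (tail v) i sucℤ) ≡⟨ cong (λ z → head v ℤ.+ z) (sum-updateAt-sucℤ (tail v) i) ⟩
  head v ℤ.+ (1ℤ ℤ.+ sum (tail v))          ≡⟨ ℤ+.x∙yz≈y∙xz (head v) 1ℤ (sum (tail v)) ⟩
  1ℤ ℤ.+ (head v ℤ.+ sum (tail v))          ∎
  where open ≡-Reasoning

updateAt-sucℤ-injective : ∀ {d} (v : Vector ℤ d) {i j} →
  (∀ x → updateAt v i sucℤ x ≡ updateAt v j sucℤ x) → i ≡ j
updateAt-sucℤ-injective v {i} {j} eq with i Fin.≟ j
... | yes i≡j = i≡j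
... | no  i≢j = contradiction (begin
  v i                    ≡⟨ Vector.updateAt-minimal i j v i≢j ⟨
  updateAt v j sucℤ i    ≡⟨ eq i ⟨
  updateAt v i sucℤ i    ≡⟨ Vector.updateAt-updates i v ⟩
  sucℤ (v i)             ∎) ℤ.i≢suc[i]
  where open ≡-Reasoning

coordIncl-refl : ∀ s {w v} → w ≡ v → coordIncl s s w v
coordIncl-refl inside  = id
coordIncl-refl outside = id

coordIncl-offset : ∀ {a b} {w v} → coordIncl a b w v →
  Σ ℕ λ δ → (w ≡ v ℤ.+ + δ) × (δ + ∣ a ∷ [] ∣ ≤ ∣ b ∷ [] ∣)
coordIncl-offset {inside}  {inside}  refl        = 0 , sym (ℤ.+-identityʳ _) , ℕ.≤-refl
coordIncl-offset {outside} {outside} refl        = 0 , sym (ℤ.+-identityʳ _) , ℕ.≤-refl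
coordIncl-offset {outside} {inside}  (inj₁ refl) = 0 , sym (ℤ.+-identityʳ _) , z≤n
coordIncl-offset {outside} {inside}  (inj₂ refl) = 1 , refl , ℕ.≤-refl

∣x∷p∣≡∣x∷[]∣+∣p∣ : ∀ {d} x (p : Subset d) → ∣ x ∷ p ∣ ≡ ∣ x ∷ [] ∣ + ∣ p ∣
∣x∷p∣≡∣x∷[]∣+∣p∣ inside  p = refl
∣x∷p∣≡∣x∷[]∣+∣p∣ outside p = refl

level-⊑ : ∀ {d} {g f : Face d} → g ⊑ f → Σ ℕ λ δ → (level g ≡ level f ℤ.+ + δ) × (δ + dim g ≤ dim f)
level-⊑ {g = face []      w} {face []      v} incl = 0 , refl , z≤n
level-⊑ {g = face (a ∷ G) w} {face (b ∷ F) v} incl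
  with δ₀ , w₀≡ , le₀ ← coordIncl-offset (incl zero)
     | δ , ∑w≡ , le ← level-⊑ {g = face G (tail w)} {face F (tail v)} (incl ∘ suc)
  = δ₀ + δ , sum≡ , count≤
  where
  sum≡ : head w ℤ.+ sum (tail w) ≡ (head v ℤ.+ sum (tail v)) ℤ.+ + (δ₀ + δ)
  sum≡ = begin
    head w ℤ.+ sum (tail w)                           ≡⟨ cong₂ ℤ._+_ w₀≡ ∑w≡ ⟩
    (head v ℤ.+ + δ₀) ℤ.+ (sum (tail v) ℤ.+ + δ)      ≡⟨ ℤ+.interchange (head v) (+ δ₀) (sum (tail v)) (+ δ) ⟩
    (head v ℤ.+ sum (tail v)) ℤ.+ (+ δ₀ ℤ.+ + δ)      ≡⟨ cong (λ z → head v ℤ.+ sum (tail v) ℤ.+ z) (ℤ.pos-+ δ₀ δ) ⟨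
    (head v ℤ.+ sum (tail v)) ℤ.+ + (δ₀ + δ)          ∎
    where open ≡-Reasoning
  count≤ : δ₀ + δ + ∣ a ∷ G ∣ ≤ ∣ b ∷ F ∣
  count≤ = begin
    δ₀ + δ + ∣ a ∷ G ∣                 ≡⟨ cong (λ n → δ₀ + δ + n) (∣x∷p∣≡∣x∷[]∣+∣p∣ a G) ⟩
    δ₀ + δ + (∣ a ∷ [] ∣ + ∣ G ∣)      ≡⟨ ℕ+.interchange δ₀ δ ∣ a ∷ [] ∣ ∣ G ∣ ⟩
    δ₀ + ∣ a ∷ [] ∣ + (δ + ∣ G ∣)      ≤⟨ ℕ.+-mono-≤ le₀ le ⟩
    ∣ b ∷ [] ∣ + ∣ F ∣                 ≡⟨ ∣x∷p∣≡∣x∷[]∣+∣p∣ b F ⟨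
    ∣ b ∷ F ∣                          ∎
    where open ℕ.≤-Reasoning

Shares : ∀ {d} → ℕ → Face d → Face d → Set
Shares {d} k f f′ = Σ (Face d) λ g → (dim g ≡ k ∸ 1) × (g ⊑ f) × (g ⊑ f′)

facet-offset : ∀ {d k} {g f : Face d} → dim g ≡ k ∸ 1 → dim f ≡ k → g ⊑ f →
  Σ ℕ λ δ → (level g ≡ level f ℤ.+ + δ) × (δ ≤ 1)
facet-offset {k = k} {g} {f} dim-g dim-f g⊑f with δ , level≡ , δ+dim≤ ← level-⊑ {g = g} {f} g⊑f
  = δ , level≡ , ℕ.+-cancelʳ-≤ (k ∸ 1) δ 1 (begin
      δ + (k ∸ 1)   ≡⟨ cong (λ n → δ + n) dim-g ⟨
      δ + dim g     ≤⟨ δ+dim≤ ⟩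
      dim f         ≡⟨ dim-f ⟩
      k             ≤⟨ ℕ.m≤n+m∸n k 1 ⟩
      1 + (k ∸ 1)   ∎)
  where open ℕ.≤-Reasoning

record IsStaircase {d} (k : ℕ) {r} (F : Fin (suc r) → Face d) : Set where
  field
    kFaces      : ∀ i → dim (F i) ≡ k
    level≡toℕ   : ∀ i → level (F i) ≡ + toℕ i
    consecutive : ∀ i → Shares k (F (inject₁ i)) (F (suc i))

  height : ∀ g i → dim g ≡ k ∸ 1 → g ⊑ F i → Σ ℕ λ δ → (level g ≡ + (toℕ i + δ)) × (δ ≤ 1)
  height g i dim-g g⊑Fi with δ , level≡ , δ≤1 ← facet-offset {g = g} {F i} dim-g (kFaces i) g⊑Fi
    = δ , trans level≡ (trans (cong (ℤ._+ + δ) (level≡toℕ i)) (sym (ℤ.pos-+ (toℕ i) δ))) , δ≤1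

  atMostTwo : ∀ g → dim g ≡ k ∸ 1 → ∀ i j l → g ⊑ F i → g ⊑ F j → g ⊑ F l → i ≡ j ⊎ j ≡ l ⊎ i ≡ l
  atMostTwo g dim-g i j l g⊑Fi g⊑Fj g⊑Fl
    with δi , gi , δi≤1 ← height g i dim-g g⊑Fi
       | δj , gj , δj≤1 ← height g j dim-g g⊑Fj
       | δl , gl , δl≤1 ← height g l dim-g g⊑Fl
    = Sum.map (cancel i j gi gj) (Sum.map (cancel j l gj gl) (cancel i l gi gl)) (≤1-pigeonhole δi≤1 δj≤1 δl≤1)
    where
    cancel : ∀ a b {δa δb} → level g ≡ + (toℕ a + δa) → level g ≡ + (toℕ b + δb) → δa ≡ δb → a ≡ b
    cancel a b ga gb refl = Fin.toℕ-injective (ℕ.+-cancelʳ-≡ _ _ _ (ℤ.+-injective (trans (sym ga) gb)))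

  adjacent : ∀ i → Adj k F (inject₁ i) (suc i)
  adjacent i = (λ eq → ℕ.1+n≢n (sym (trans (sym (Fin.toℕ-inject₁ i)) (cong toℕ eq)))) , consecutive i

  Adj-sym : ∀ {i j} → Adj k F i j → Adj k F j i
  Adj-sym (i≢j , g , dim-g , g⊑Fi , g⊑Fj) = (i≢j ∘ sym) , g , dim-g , g⊑Fj , g⊑Fi

  isSAM : IsSAM d k (suc r) F
  isSAM = record
    { distinct  = λ i j Fi≡Fj → Fin.toℕ-injective (ℤ.+-injective
                    (trans (sym (level≡toℕ i)) (trans (level-cong Fi≡Fj) (level≡toℕ j))))
    ; kFaces    = kFaces
    ; atMostTwo = atMostTwo
    ; connected = λ i j → reverse Adj-sym (star-from-zero _ adjacent i) ◅◅ star-from-zero _ adjacent j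
    }

nonneg-shift-into-range : ∀ {z : ℤ} {a b r} → z ≡ + a → z ℤ.+ + r ≡ + b → b ≤ r → z ≡ 0ℤ
nonneg-shift-into-range {a = a} {b} {r} refl a+r≡b b≤r = cong +_ (ℕ.n≤0⇒n≡0 (ℕ.+-cancelʳ-≤ r a 0 (begin
  a + r ≡⟨ ℤ.+-injective (trans (ℤ.pos-+ a r) a+r≡b) ⟩
  b     ≤⟨ b≤r ⟩
  r     ∎)))
  where open ℕ.≤-Reasoning

staircase-rigid : ∀ {d k r} {F G : Fin (suc r) → Face d} → IsStaircase k F → IsStaircase k G →
  FaceEq (F zero) (G zero) → ∀ t → (∀ i → Σ (Fin (suc r)) λ j → FaceEq (translate t (F i)) (G j)) →
  ∀ i → FaceEq (F i) (G i)
staircase-rigid {r = r} {F} {G} SF SG F₀≡G₀ t image i =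
  proj₁ (translate-fixes i) , λ x → begin
    base (F i) x               ≡⟨ ℤ.+-identityˡ _ ⟨
    0ℤ ℤ.+ base (F i) x        ≡⟨ cong (ℤ._+ base (F i) x) (t≡0 x) ⟨
    t x ℤ.+ base (F i) x       ≡⟨ proj₂ (translate-fixes i) x ⟩
    base (G i) x               ∎
  where
  open ≡-Reasoning
  open IsStaircase using (level≡toℕ)

  j : Fin (suc r) → Fin (suc r)
  j = proj₁ ∘ image

  shift : ∀ i → sum t ℤ.+ + toℕ i ≡ + toℕ (j i)
  shift i = begin
    sum t ℤ.+ + toℕ i          ≡⟨ cong (λ z → sum t ℤ.+ z) (level≡toℕ SF i) ⟨
    sum t ℤ.+ level (F i)      ≡⟨ level-translate t (F i) ⟨
    level (translate t (F i))  ≡⟨ level-cong (proj₂ (image i)) ⟩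
    level (G (j i))            ≡⟨ level≡toℕ SG (j i) ⟩
    + toℕ (j i)                ∎

  ∑t≡0 : sum t ≡ 0ℤ
  ∑t≡0 = nonneg-shift-into-range (trans (sym (ℤ.+-identityʳ (sum t))) (shift zero))
           (trans (cong (λ n → sum t ℤ.+ + n) (sym (Fin.toℕ-fromℕ r))) (shift (fromℕ r)))
           (Fin.toℕ≤pred[n] (j (fromℕ r)))

  j≡id : ∀ i → j i ≡ i
  j≡id i = Fin.toℕ-injective (ℤ.+-injective (begin
    + toℕ (j i)          ≡⟨ shift i ⟨
    sum t ℤ.+ + toℕ i    ≡⟨ cong (ℤ._+ + toℕ i) ∑t≡0 ⟩
    + toℕ i              ∎))

  translate-fixes : ∀ i → FaceEq (translate t (F i)) (G i)
  translate-fixes i = subst (λ a → FaceEq (translate t (F i)) (G a)) (j≡id i) (proj₂ (image i))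

  t≡0 : ∀ x → t x ≡ 0ℤ
  t≡0 x = identityˡ-unique (t x) (base (F zero) x) (begin
    t x ℤ.+ base (F zero) x  ≡⟨ proj₂ (translate-fixes zero) x ⟩
    base (G zero) x          ≡⟨ proj₂ F₀≡G₀ x ⟨
    base (F zero) x          ∎)

KFace : ℕ → ℕ → Set
KFace d k = Σ (Face d) λ f → dim f ≡ k

Move : ℕ → ℕ → Set
Move d k = Fin k × Fin (d ∸ k + 1)

module Step {d k} (H : Subset d) (v : Vector ℤ d) (∣H∣≡k : ∣ H ∣ ≡ k) where

  dropped : Fin k → Fin d
  dropped p = member H (cast (sym ∣H∣≡k) p)

  dropped∈H : ∀ p → lookup H (dropped p) ≡ inside
  dropped∈H p = member∈ H _

  module _ (p : Fin k) where

    H⁻ : Subset d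
    H⁻ = H [ dropped p ]≔ outside

    v⁺ : Vector ℤ d
    v⁺ = updateAt v (dropped p) sucℤ

    facet : Face d
    facet = face H⁻ v⁺

    suc∣H⁻∣≡k : suc ∣ H⁻ ∣ ≡ k
    suc∣H⁻∣≡k = trans (suc∣p[i]≔outside∣≡∣p∣ H _ (dropped∈H p)) ∣H∣≡k

    ∣∁H⁻∣≡d∸k+1 : ∣ ∁ H⁻ ∣ ≡ d ∸ k + 1
    ∣∁H⁻∣≡d∸k+1 = begin
      ∣ ∁ H⁻ ∣       ≡⟨ ∣∁[p[i]≔outside]∣≡suc∣∁p∣ H _ (dropped∈H p) ⟩
      suc ∣ ∁ H ∣    ≡⟨ cong suc (Subset.∣∁p∣≡n∸∣p∣ H) ⟩
      suc (d ∸ ∣ H ∣) ≡⟨ cong (λ n → suc (d ∸ n)) ∣H∣≡k ⟩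
      suc (d ∸ k)    ≡⟨ ℕ.+-comm 1 (d ∸ k) ⟩
      d ∸ k + 1      ∎
      where open ≡-Reasoning

    added : Fin (d ∸ k + 1) → Fin d
    added q = member (∁ H⁻) (cast (sym ∣∁H⁻∣≡d∸k+1) q)

    added∉H⁻ : ∀ q → lookup H⁻ (added q) ≡ outside
    added∉H⁻ q = lookup-∁ H⁻ _ (member∈ (∁ H⁻) _)

    next : Fin (d ∸ k + 1) → Face d
    next q = face (H⁻ [ added q ]≔ inside) v⁺

    dim-facet : dim facet ≡ k ∸ 1
    dim-facet = cong (_∸ 1) suc∣H⁻∣≡k

    dim-next : ∀ q → dim (next q) ≡ k
    dim-next q = trans (∣p[i]≔inside∣≡suc∣p∣ H⁻ _ (added∉H⁻ q)) suc∣H⁻∣≡k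

    facet⊑current : facet ⊑ face H v
    facet⊑current x with dropped p Fin.≟ x
    ... | yes refl rewrite Vec.lookup∘update (dropped p) H outside | dropped∈H p
                         | Vector.updateAt-updates (dropped p) {sucℤ} v = inj₂ (ℤ.+-comm 1ℤ (v x))
    ... | no  i≢x  rewrite Vec.lookup∘update′ (i≢x ∘ sym) H outside
                         | Vector.updateAt-minimal x (dropped p) {sucℤ} v (i≢x ∘ sym) = coordIncl-refl (lookup H x) refl

    facet⊑next : ∀ q → facet ⊑ next q
    facet⊑next q x with added q Fin.≟ x
    ... | yes refl rewrite Vec.lookup∘update (added q) H⁻ inside | added∉H⁻ q = inj₁ refl
    ... | no  j≢x  rewrite Vec.lookup∘update′ (j≢x ∘ sym) H⁻ inside = coordIncl-refl (lookup H⁻ x) refl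

  next-injective : ∀ {p p′ q q′} → FaceEq (next p q) (next p′ q′) → (p , q) ≡ (p′ , q′)
  next-injective {p} {p′} {q} {q′} (dirs≡ , base≡)
    with refl ← cast-injective (sym ∣H∣≡k) {p} {p′} (member-injective H (updateAt-sucℤ-injective v base≡))
    with refl ← cast-injective (sym (∣∁H⁻∣≡d∸k+1 p)) {q} {q′}
                  (member-injective (∁ (H⁻ p)) ([]≔inside-injective (H⁻ p) (added∉H⁻ p q) dirs≡))
    = refl

step : ∀ {d k} → KFace d k → Move d k → KFace d k
step (face H v , ∣H∣≡k) (p , q) = Step.next H v ∣H∣≡k p q , Step.dim-next H v ∣H∣≡k p q

level-step : ∀ {d k} (s : KFace d k) m → level (proj₁ (step s m)) ≡ sucℤ (level (proj₁ s))
level-step (face H v , _) (p , _) = sum-updateAt-sucℤ v _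

step-shares : ∀ {d k} (s : KFace d k) m → Shares k (proj₁ s) (proj₁ (step s m))
step-shares (face H v , ∣H∣≡k) (p , q) = facet p , dim-facet p , facet⊑current p , facet⊑next p q
  where open Step H v ∣H∣≡k

step-injective : ∀ {d k} (s : KFace d k) {m m′} → FaceEq (proj₁ (step s m)) (proj₁ (step s m′)) → m ≡ m′
step-injective (face H v , ∣H∣≡k) = Step.next-injective H v ∣H∣≡k

walk : ∀ {d k r} → KFace d k → (Fin r → Move d k) → Fin (suc r) → KFace d k
walk s ms zero                = s
walk {r = suc r} s ms (suc t) = walk (step s (ms zero)) (ms ∘ suc) t

level-walk : ∀ {d k r} (s : KFace d k) (ms : Fin r → Move d k) t →
  level (proj₁ (walk s ms t)) ≡ level (proj₁ s) ℤ.+ + toℕ t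
level-walk s ms zero                = sym (ℤ.+-identityʳ _)
level-walk {r = suc r} s ms (suc t) = begin
  level (proj₁ (walk (step s (ms zero)) (ms ∘ suc) t))  ≡⟨ level-walk (step s (ms zero)) (ms ∘ suc) t ⟩
  level (proj₁ (step s (ms zero))) ℤ.+ + toℕ t          ≡⟨ cong (ℤ._+ + toℕ t) (level-step s (ms zero)) ⟩
  (1ℤ ℤ.+ level (proj₁ s)) ℤ.+ + toℕ t                 ≡⟨ ℤ+.xy∙z≈y∙xz 1ℤ (level (proj₁ s)) (+ toℕ t) ⟩
  level (proj₁ s) ℤ.+ (1ℤ ℤ.+ + toℕ t)                  ≡⟨ cong (λ z → level (proj₁ s) ℤ.+ z) (ℤ.pos-+ 1 (toℕ t)) ⟨
  level (proj₁ s) ℤ.+ + suc (toℕ t)                     ∎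
  where open ≡-Reasoning

walk-shares : ∀ {d k r} (s : KFace d k) (ms : Fin r → Move d k) t →
  Shares k (proj₁ (walk s ms (inject₁ t))) (proj₁ (walk s ms (suc t)))
walk-shares s ms zero    = step-shares s (ms zero)
walk-shares s ms (suc t) = walk-shares (step s (ms zero)) (ms ∘ suc) t

walk-injective : ∀ {d k r} (s : KFace d k) (ms ms′ : Fin r → Move d k) →
  (∀ t → FaceEq (proj₁ (walk s ms t)) (proj₁ (walk s ms′ t))) → ∀ t → ms t ≡ ms′ t
walk-injective s ms ms′ same zero = step-injective s (same (suc zero))
walk-injective {d} {k} s ms ms′ same (suc t) =
  walk-injective (step s (ms′ zero)) (ms ∘ suc) (ms′ ∘ suc) (subst Same (step-injective s (same (suc zero))) (same ∘ suc)) t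
  where
  Same : Move d k → Set
  Same m = ∀ t → FaceEq (proj₁ (walk (step s m) (ms ∘ suc) t)) (proj₁ (walk (step s (ms′ zero)) (ms′ ∘ suc) t))

subsetOfSize : ∀ {d k} → k ≤ d → Σ (Subset d) λ H → ∣ H ∣ ≡ k
subsetOfSize {d}     {zero}  _          = Subset.⊥ , Subset.∣⊥∣≡0 d
subsetOfSize {suc d} {suc k} (s≤s k≤d) with H , ∣H∣≡k ← subsetOfSize k≤d = inside ∷ H , cong suc ∣H∣≡k

origin : ∀ {d k} → k ≤ d → KFace d k
origin k≤d = face (proj₁ (subsetOfSize k≤d)) (λ _ → 0ℤ) , proj₂ (subsetOfSize k≤d)

walk-isStaircase : ∀ {d k r} (k≤d : k ≤ d) (ms : Fin r → Move d k) → IsStaircase k (proj₁ ∘ walk (origin k≤d) ms)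
walk-isStaircase {d} k≤d ms = record
  { kFaces      = proj₂ ∘ walk (origin k≤d) ms
  ; level≡toℕ   = λ t → trans (level-walk (origin k≤d) ms t)
                    (trans (cong (ℤ._+ + toℕ t) (sum-replicate-zero d)) (ℤ.+-identityˡ (+ toℕ t)))
  ; consecutive = walk-shares (origin k≤d) ms
  }

staircase-classes : ∀ {d k} → k ≤ d → ∀ r → AtLeastClasses d k (suc r) ((k * (d ∸ k + 1)) ^ r)
staircase-classes {d} {k} k≤d r = sam ∘ moves , distinct
  where
  moves : Fin ((k * (d ∸ k + 1)) ^ r) → Fin r → Move d k
  moves x = remQuot {k} (d ∸ k + 1) ∘ finToFun {n = r} x

  sam : (Fin r → Move d k) → SAM d k (suc r)
  sam ms = proj₁ ∘ walk (origin k≤d) ms , IsStaircase.isSAM (walk-isStaircase k≤d ms)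

  distinct : ∀ x y → Translates (sam (moves x)) (sam (moves y)) → x ≡ y
  distinct x y (t , image) = finToFun-injective (k * (d ∸ k + 1)) r λ i → remQuot-injective k (d ∸ k + 1)
    (walk-injective (origin k≤d) (moves x) (moves y)
      (staircase-rigid (walk-isStaircase k≤d _) (walk-isStaircase k≤d _) (refl , λ _ → refl) t image) i)

mainTheorem7 : ∀ (d k : ℕ) → 1 < k → k < d →
    ∀ (a b : ℕ) → 0 < b → a < b * (k * (d ∸ k + 1)) →
    Σ ℕ (λ N → ∀ (n : ℕ) → N ≤ n →
      Σ ℕ (λ m → (a ^ n < b ^ n * m) × AtLeastClasses d k n m))
mainTheorem7 d k _ k<d a b _ a<bL = suc (a * L) , eventually
  where
  L = k * (d ∸ k + 1)
  eventually : ∀ n → suc (a * L) ≤ n → Σ ℕ λ m → (a ^ n < b ^ n * m) × AtLeastClasses d k n m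
  eventually (suc r) (s≤s aL≤r) = L ^ r , a^[1+r]<b^[1+r]*L^r {b = b} r a<bL (ℕ.m≤n⇒m≤1+n aL≤r) , staircase-classes (ℕ.<⇒≤ k<d) r
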